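{- For every finite set $\Gamma$ of formulas and finite multiset $\Delta$ of formulas: $(\Gamma;\Delta)\preceq_s(\cdot;\,!\Gamma,\Delta)$ and $(\cdot;\,!\Gamma,\Delta)\preceq_s(\Gamma;\Delta)$.
   Context: Formulas: $A,B,C ::= a \mid \mathbf{1} \mid A\otimes B \mid \top \mid A \,\&\, B \mid a \multimap B \mid\ !A$, with $a$ ranging over atomic formulas. Contexts $\Gamma,\Delta$ are finite multisets of formulas; "$\Delta_1,\Delta_2$" is multiset union, "$\cdot$" the empty context. $!\Gamma$ is the multiset obtained by prefixing every formula of $\Gamma$ with $!$. States are pairs $(\Gamma;\Delta)$ modulo structural congruence $\equiv$: $\Delta$ is a multiset and $\Gamma$ a set ($(\Gamma,A,A;\Delta)\equiv(\Gamma,A;\Delta)$); congruent states are identified. Composition: $((\Gamma_1;\Delta_1),(\Gamma_2;\Delta_2)) := (\Gamma_1,\Gamma_2;\Delta_1,\Delta_2)$. Labelled transitions with labels $\tau$, $!a$, $?a$ ($a$ atomic) are generated by: $(\Gamma;\Delta,a)\xrightarrow{!a}(\Gamma;\Delta)$; $(\Gamma;\Delta,a\multimap B)\xrightarrow{?a}(\Gamma;\Delta,B)$; if $S_1\xrightarrow{!a}S_1'$ and $S_2\xrightarrow{?a}S_2'$ then $(S_1,S_2)\xrightarrow{\tau}(S_1',S_2')$; $(\Gamma;\Delta,A\otimes B)\xrightarrow{\tau}(\Gamma;\Delta,A,B)$; $(\Gamma;\Delta,\mathbf 1)\xrightarrow{\tau}(\Gamma;\Delta)$; $(\Gamma;\Delta,A_1\&A_2)\xrightarrow{\tau}(\Gamma;\Delta,A_i)$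 for $i=1,2$; $(\Gamma;\Delta,!A)\xrightarrow{\tau}(\Gamma,A;\Delta)$; $(\Gamma,A;\Delta)\xrightarrow{\tau}(\Gamma,A;\Delta,A)$ (no rule for $\top$). $\alpha$ ranges over $\tau$ and $!a$. $\overset{\tau}{\Longrightarrow}$ is the reflexive transitive closure of $\xrightarrow{\tau}$; for $\beta\ne\tau$, $\overset{\beta}{\Longrightarrow}$ is $\overset{\tau}{\Longrightarrow}\xrightarrow{\beta}\overset{\tau}{\Longrightarrow}$. A relation $\mathcal R$ on states is a simulation if $(\Gamma_1;\Delta_1)\mathcal R(\Gamma_2;\Delta_2)$ implies: (1) if $(\Gamma_1;\Delta_1)\equiv(\Gamma_1';\cdot)$ then $(\Gamma_2;\Delta_2)\overset{\tau}{\Longrightarrow}(\Gamma_2';\cdot)$ with $(\Gamma_1';\cdot)\mathcal R(\Gamma_2';\cdot)$; (2) if $(\Gamma_1;\Delta_1)\equiv((\Gamma_1';\Delta_1'),(\Gamma_1'';\Delta_1''))$ then $(\Gamma_2;\Delta_2)\overset{\tau}{\Longrightarrow}((\Gamma_2';\Delta_2'),(\Gamma_2'';\Delta_2''))$ with $(\Gamma_1';\Delta_1')\mathcal R(\Gamma_2';\Delta_2')$ and $(\Gamma_1'';\Delta_1'')\mathcal R(\Gamma_2'';\Delta_2'')$; (3) if $(\Gamma_1;\Delta_1)\xrightarrow{\alpha}(\Gamma_1';\Delta_1')$ then $(\Gamma_2;\Delta_2)\overset{\alpha}{\Longrightarrow}(\Gamma_2';\Delta_2')$ with $(\Gamma_1';\Delta_1')\mathcal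 R(\Gamma_2';\Delta_2')$; (4) if $(\Gamma_1;\Delta_1)\xrightarrow{?a}(\Gamma_1';\Delta_1')$ then $(\Gamma_2;\Delta_2,a)\overset{\tau}{\Longrightarrow}(\Gamma_2';\Delta_2')$ with $(\Gamma_1';\Delta_1')\mathcal R(\Gamma_2';\Delta_2')$. $S_1\preceq_s S_2$ iff some simulation relates $S_1$ to $S_2$. -}

module Defs where

open import Data.Nat using (ℕ)
open import Data.List using (List; []; _∷_; _++_; map)
open import Data.List.Membership.Propositional using (_∈_)
open import Data.List.Relation.Binary.Permutation.Propositional using (_↭_)
open import Data.Product using (Σ; _×_; _,_; ∃)
open import Relation.Binary.Construct.Closure.ReflexiveTransitive using (Star)
open import Function.Bundles using (_⇔_)
open import Level using (Level; suc; _⊔_) renaming (zero to lzero)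

Atom : Set
Atom = ℕ

infixr 6 _⊗_
infixr 6 _&_
infixr 5 _⊸_

data Formula : Set where
  atom : Atom → Formula
  𝟏    : Formula
  _⊗_  : Formula → Formula → Formula
  ⊤    : Formula
  _&_  : Formula → Formula → Formula
  _⊸_  : Atom → Formula → Formula
  !_   : Formula → Formula

-- A state (Γ ; Δ): Γ is read as a set, Δ as a multiset (lists as representatives).
record State : Set where
  constructor ⟨_∣_⟩
  field
    unr : List Formula
    lin : List Formula
open State public

_≅_ : State → State → Set
⟨ Γ ∣ Δ ⟩ ≅ ⟨ Γ' ∣ Δ' ⟩ = (∀ A → (A ∈ Γ) ⇔ (A ∈ Γ')) × (Δ ↭ Δ')

_∥_ : State → State → State
⟨ Γ₁ ∣ Δ₁ ⟩ ∥ ⟨ Γ₂ ∣ Δ₂ ⟩ = ⟨ Γ₁ ++ Γ₂ ∣ Δ₁ ++ Δ₂ ⟩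

data Label : Set where
  τ  : Label
  !ₗ : Atom → Label
  ?ₗ : Atom → Label

-- Labelled transitions, on congruence classes (closed under ≅ by the rule `cong`).
data _—[_]→_ : State → Label → State → Set where
  out   : ∀ {Γ Δ a} → ⟨ Γ ∣ atom a ∷ Δ ⟩ —[ !ₗ a ]→ ⟨ Γ ∣ Δ ⟩
  inp   : ∀ {Γ Δ a B} → ⟨ Γ ∣ (a ⊸ B) ∷ Δ ⟩ —[ ?ₗ a ]→ ⟨ Γ ∣ B ∷ Δ ⟩
  sync  : ∀ {S₁ S₁' S₂ S₂' a} → S₁ —[ !ₗ a ]→ S₁' → S₂ —[ ?ₗ a ]→ S₂' →
          (S₁ ∥ S₂) —[ τ ]→ (S₁' ∥ S₂')
  tens  : ∀ {Γ Δ A B} → ⟨ Γ ∣ (A ⊗ B) ∷ Δ ⟩ —[ τ ]→ ⟨ Γ ∣ A ∷ B ∷ Δ ⟩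
  one   : ∀ {Γ Δ} → ⟨ Γ ∣ 𝟏 ∷ Δ ⟩ —[ τ ]→ ⟨ Γ ∣ Δ ⟩
  with₁ : ∀ {Γ Δ A B} → ⟨ Γ ∣ (A & B) ∷ Δ ⟩ —[ τ ]→ ⟨ Γ ∣ A ∷ Δ ⟩
  with₂ : ∀ {Γ Δ A B} → ⟨ Γ ∣ (A & B) ∷ Δ ⟩ —[ τ ]→ ⟨ Γ ∣ B ∷ Δ ⟩
  bang  : ∀ {Γ Δ A} → ⟨ Γ ∣ (! A) ∷ Δ ⟩ —[ τ ]→ ⟨ A ∷ Γ ∣ Δ ⟩
  copy  : ∀ {Γ Δ A} → A ∈ Γ → ⟨ Γ ∣ Δ ⟩ —[ τ ]→ ⟨ Γ ∣ A ∷ Δ ⟩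
  cong  : ∀ {S S₀ S₀' S' l} → S ≅ S₀ → S₀ —[ l ]→ S₀' → S₀' ≅ S' → S —[ l ]→ S'

_⇒τ_ : State → State → Set
S ⇒τ S' = Star (λ X Y → X —[ τ ]→ Y) S S'

-- Weak β-transition for β ≠ τ.
_⇒[_]_ : State → Label → State → Set
S ⇒[ β ] S' = Σ State λ X → Σ State λ Y → (S ⇒τ X) × (X —[ β ]→ Y) × (Y ⇒τ S')

Rel : Set₁
Rel = State → State → Set

record IsSimulation (R : Rel) : Set where
  field
    resp : ∀ {S₁ S₁' S₂ S₂'} → S₁ ≅ S₁' → S₂ ≅ S₂' → R S₁ S₂ → R S₁' S₂'
    empty : ∀ {S₁ S₂ Γ₁'} → R S₁ S₂ → S₁ ≅ ⟨ Γ₁' ∣ [] ⟩ →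
            Σ (List Formula) λ Γ₂' → Σ State λ T → (S₂ ⇒τ T) × (T ≅ ⟨ Γ₂' ∣ [] ⟩) × R ⟨ Γ₁' ∣ [] ⟩ ⟨ Γ₂' ∣ [] ⟩
    split : ∀ {S₁ S₂ S₁' S₁''} → R S₁ S₂ → S₁ ≅ (S₁' ∥ S₁'') →
            Σ State λ S₂' → Σ State λ S₂'' →
              Σ State λ T → (S₂ ⇒τ T) × (T ≅ (S₂' ∥ S₂'')) × R S₁' S₂' × R S₁'' S₂''
    stepτ : ∀ {S₁ S₂ S₁'} → R S₁ S₂ → S₁ —[ τ ]→ S₁' →
            Σ State λ S₂' → (S₂ ⇒τ S₂') × R S₁' S₂'
    step! : ∀ {S₁ S₂ S₁' a} → R S₁ S₂ → S₁ —[ !ₗ a ]→ S₁' →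
            Σ State λ S₂' → (S₂ ⇒[ !ₗ a ] S₂') × R S₁' S₂'
    step? : ∀ {S₁ Γ₂ Δ₂ S₁' a} → R S₁ ⟨ Γ₂ ∣ Δ₂ ⟩ → S₁ —[ ?ₗ a ]→ S₁' →
            Σ State λ S₂' → (⟨ Γ₂ ∣ atom a ∷ Δ₂ ⟩ ⇒τ S₂') × R S₁' S₂'

_≼ₛ_ : State → State → Set₁
S₁ ≼ₛ S₂ = Σ Rel λ R → IsSimulation R × R S₁ S₂

bangs : List Formula → List Formula
bangs = map !_

-- Firing the top-level !A of the linear context (the τ-moves that move A into the
-- unrestricted context) commutes with every other transition. So every state S reaches
-- its normal form promote S, promote S matches every transition of S up to weak τ-moves,
-- and therefore "T reaches promote S" is a simulation relating S to T. The two states of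
-- the theorem have congruent normal forms, so each simulates the other.
module Submission where

open import Defs
open import Data.List using (List; []; _∷_; _++_; [_]; concatMap)
import Data.List.Properties as List
open import Data.List.Membership.Propositional.Properties using (∈-++⁺ˡ; ∈-++⁺ʳ)
open import Data.List.Relation.Binary.BagAndSetEquality
  using (_∼[_]_; set; [_]-Equality; bag-=⇒; ↭⇒∼bag; ++-cong)
open import Data.List.Relation.Binary.Permutation.Propositional
  using (_↭_; prep; swap; ↭-refl; ↭-sym; ↭-trans; ↭-reflexive; module PermutationReasoning)
open import Data.List.Relation.Binary.Permutation.Propositional.Properties
  using (++⁺; ++⁺ˡ; ++-comm; ++-assoc; shift; shifts; ++-commutativeMonoid)
open import Data.List.Relation.Unary.Unique.Propositional using (Unique)
open import Algebra.Bundles using (CommutativeMonoid)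
import Algebra.Properties.CommutativeSemigroup as CommutativeSemigroupProperties
open import Data.Product using (Σ; _×_; _,_; proj₂)
open import Relation.Binary.Bundles using (Preorder; Setoid)
open import Relation.Binary.Construct.Closure.ReflexiveTransitive using (ε; _◅_; _◅◅_; gmap)
open import Relation.Binary.PropositionalEquality as ≡ using (_≡_; refl)
import Relation.Binary.Reasoning.Preorder as PreorderReasoning

private
  variable
    Γ Γ' Δ Δ' : List Formula
    S S' T T' U X X' Y Y' : State
    l : Label
    a : Atom

  module SetEq = Setoid ([ set ]-Equality Formula)

↭⇒∼set : Γ ↭ Γ' → Γ ∼[ set ] Γ'
↭⇒∼set Γ↭Γ' = bag-=⇒ (↭⇒∼bag Γ↭Γ')

≅-intro : Γ ∼[ set ] Γ' → Δ ↭ Δ' → ⟨ Γ ∣ Δ ⟩ ≅ ⟨ Γ' ∣ Δ' ⟩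
≅-intro Γ≈Γ' Δ↭Δ' = (λ _ → Γ≈Γ') , Δ↭Δ'

↭⇒≅ : Γ ↭ Γ' → Δ ↭ Δ' → ⟨ Γ ∣ Δ ⟩ ≅ ⟨ Γ' ∣ Δ' ⟩
↭⇒≅ Γ↭Γ' = ≅-intro (↭⇒∼set Γ↭Γ')

≅-unr : S ≅ S' → unr S ∼[ set ] unr S'
≅-unr (Γ≈Γ' , _) {A} = Γ≈Γ' A

≅-refl : S ≅ S
≅-refl = ≅-intro SetEq.refl ↭-refl

≅-sym : S ≅ S' → S' ≅ S
≅-sym S≅S' = ≅-intro (SetEq.sym (≅-unr S≅S')) (↭-sym (proj₂ S≅S'))

≅-trans : S ≅ S' → S' ≅ T → S ≅ T
≅-trans S≅S' S'≅T = ≅-intro (SetEq.trans (≅-unr S≅S') (≅-unr S'≅T)) (↭-trans (proj₂ S≅S') (proj₂ S'≅T))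

∥-cong : S ≅ S' → T ≅ T' → (S ∥ T) ≅ (S' ∥ T')
∥-cong S≅S' T≅T' = ≅-intro (++-cong (≅-unr S≅S') (≅-unr T≅T')) (++⁺ (proj₂ S≅S') (proj₂ T≅T'))

∥-comm : ∀ S T → (S ∥ T) ≅ (T ∥ S)
∥-comm S T = ↭⇒≅ (++-comm (unr S) (unr T)) (++-comm (lin S) (lin T))

∥-assoc : ∀ S T U → ((S ∥ T) ∥ U) ≅ (S ∥ (T ∥ U))
∥-assoc S T U = ↭⇒≅ (++-assoc (unr S) (unr T) (unr U)) (++-assoc (lin S) (lin T) (lin U))

∥-stepˡ : S —[ l ]→ S' → (S ∥ T) —[ l ]→ (S' ∥ T)
∥-stepˡ out = out
∥-stepˡ inp = inp
∥-stepˡ {T = T} (sync {S₁} {S₁'} {S₂} {S₂'} d₁ d₂) =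
  cong (∥-assoc S₁ S₂ T) (sync d₁ (∥-stepˡ d₂)) (≅-sym (∥-assoc S₁' S₂' T))
∥-stepˡ tens = tens
∥-stepˡ one = one
∥-stepˡ with₁ = with₁
∥-stepˡ with₂ = with₂
∥-stepˡ bang = bang
∥-stepˡ (copy A∈Γ) = copy (∈-++⁺ˡ A∈Γ)
∥-stepˡ (cong S≅ d S'≅) = cong (∥-cong S≅ ≅-refl) (∥-stepˡ d) (∥-cong S'≅ ≅-refl)

∥-stepʳ : T —[ l ]→ T' → (S ∥ T) —[ l ]→ (S ∥ T')
∥-stepʳ {T = T} {T' = T'} {S = S} d = cong (∥-comm S T) (∥-stepˡ d) (∥-comm T' S)

_⇒≅_ : State → State → Set
X ⇒≅ Y = Σ State λ Z → (X ⇒τ Z) × (Z ≅ Y)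

≅⇒⇒≅ : X ≅ Y → X ⇒≅ Y
≅⇒⇒≅ X≅Y = _ , ε , X≅Y

τ⇒⇒≅ : X —[ τ ]→ Y → X ⇒≅ Y
τ⇒⇒≅ d = _ , d ◅ ε , ≅-refl

⇒≅-trans : X ⇒≅ Y → Y ⇒≅ U → X ⇒≅ U
⇒≅-trans (_ , X⇒ , ≅Y) (_ , ε , ≅U) = _ , X⇒ , ≅-trans ≅Y ≅U
⇒≅-trans (_ , X⇒ , ≅Y) (_ , d ◅ ds , ≅U) = _ , X⇒ ◅◅ cong ≅Y d ≅-refl ◅ ds , ≅U

⇒≅-preorder : Preorder _ _ _
⇒≅-preorder = record
  { Carrier = State
  ; _≈_ = _≅_
  ; _≲_ = _⇒≅_
  ; isPreorder = record
    { isEquivalence = record { refl = ≅-refl ; sym = ≅-sym ; trans = ≅-trans }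
    ; reflexive = ≅⇒⇒≅
    ; trans = ⇒≅-trans
    }
  }

module ⇒≅-Reasoning = PreorderReasoning ⇒≅-preorder

⇒≅-refl : X ⇒≅ X
⇒≅-refl = ≅⇒⇒≅ ≅-refl

⇒≅-∥ : X ⇒≅ X' → Y ⇒≅ Y' → (X ∥ Y) ⇒≅ (X' ∥ Y')
⇒≅-∥ {Y = Y} (Z , X⇒Z , Z≅) (W , Y⇒W , W≅) =
  Z ∥ W , gmap (_∥ Y) ∥-stepˡ X⇒Z ◅◅ gmap (Z ∥_) ∥-stepʳ Y⇒W , ∥-cong Z≅ W≅

⇒≅-unfold : X ⇒≅ Y → Σ State λ Z → (X ⇒τ Z) × (Z ⇒≅ Y)
⇒≅-unfold (Z , X⇒Z , Z≅Y) = Z , X⇒Z , ≅⇒⇒≅ Z≅Y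

unbang₁ : Formula → List Formula
unbang₁ (! A) = [ A ]
unbang₁ _ = []

nonbang₁ : Formula → List Formula
nonbang₁ (! _) = []
nonbang₁ A = [ A ]

unbang : List Formula → List Formula
unbang = concatMap unbang₁

nonbang : List Formula → List Formula
nonbang = concatMap nonbang₁

promote : State → State
promote ⟨ Γ ∣ Δ ⟩ = ⟨ unbang Δ ++ Γ ∣ nonbang Δ ⟩

module _ {A B : Set} (f : A → List B) where

  concatMap-++ : ∀ xs ys → concatMap f (xs ++ ys) ≡ concatMap f xs ++ concatMap f ys
  concatMap-++ [] ys = refl
  concatMap-++ (x ∷ xs) ys = ≡.trans (≡.cong (f x ++_) (concatMap-++ xs ys)) (≡.sym (List.++-assoc (f x) _ _))

  concatMap-↭ : ∀ {xs ys} → xs ↭ ys → concatMap f xs ↭ concatMap f ys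
  concatMap-↭ _↭_.refl = ↭-refl
  concatMap-↭ (prep x p) = ++⁺ˡ (f x) (concatMap-↭ p)
  concatMap-↭ (swap x y p) = ↭-trans (shifts (f x) (f y)) (++⁺ˡ (f y) (++⁺ˡ (f x) (concatMap-↭ p)))
  concatMap-↭ (_↭_.trans p q) = ↭-trans (concatMap-↭ p) (concatMap-↭ q)

module ++-↭-Properties =
  CommutativeSemigroupProperties (CommutativeMonoid.commutativeSemigroup (++-commutativeMonoid {A = Formula}))

unbang-bangs : ∀ Γ → unbang (bangs Γ) ≡ Γ
unbang-bangs [] = refl
unbang-bangs (A ∷ Γ) = ≡.cong (A ∷_) (unbang-bangs Γ)

nonbang-bangs : ∀ Γ → nonbang (bangs Γ) ≡ []
nonbang-bangs [] = refl
nonbang-bangs (_ ∷ Γ) = nonbang-bangs Γ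

promote-resp : S ≅ S' → promote S ≅ promote S'
promote-resp S≅S' =
  ≅-intro (++-cong (↭⇒∼set (concatMap-↭ unbang₁ Δ↭Δ')) (≅-unr S≅S')) (concatMap-↭ nonbang₁ Δ↭Δ')
  where Δ↭Δ' = proj₂ S≅S'

promote-∥ : ∀ S T → promote (S ∥ T) ≅ (promote S ∥ promote T)
promote-∥ ⟨ Γ₁ ∣ Δ₁ ⟩ ⟨ Γ₂ ∣ Δ₂ ⟩ = ↭⇒≅ unr-↭ (↭-reflexive (concatMap-++ nonbang₁ Δ₁ Δ₂))
  where
  open PermutationReasoning
  unr-↭ : unbang (Δ₁ ++ Δ₂) ++ Γ₁ ++ Γ₂ ↭ (unbang Δ₁ ++ Γ₁) ++ unbang Δ₂ ++ Γ₂
  unr-↭ = begin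
    unbang (Δ₁ ++ Δ₂) ++ Γ₁ ++ Γ₂          ≡⟨ ≡.cong (_++ Γ₁ ++ Γ₂) (concatMap-++ unbang₁ Δ₁ Δ₂) ⟩
    (unbang Δ₁ ++ unbang Δ₂) ++ Γ₁ ++ Γ₂   ↭⟨ ++-↭-Properties.interchange (unbang Δ₁) (unbang Δ₂) Γ₁ Γ₂ ⟩
    (unbang Δ₁ ++ Γ₁) ++ unbang Δ₂ ++ Γ₂   ∎

promote-++ : ∀ Θ → promote ⟨ Γ ∣ Θ ++ Δ ⟩ ≡ ⟨ unbang Θ ++ unbang Δ ++ Γ ∣ nonbang Θ ++ nonbang Δ ⟩
promote-++ {Γ} {Δ} Θ = ≡.cong₂ ⟨_∣_⟩
  (≡.trans (≡.cong (_++ Γ) (concatMap-++ unbang₁ Θ Δ)) (List.++-assoc (unbang Θ) (unbang Δ) Γ))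
  (concatMap-++ nonbang₁ Θ Δ)

promote-bangs : ∀ Γ Δ → promote ⟨ [] ∣ bangs Γ ++ Δ ⟩ ≅ promote ⟨ Γ ∣ Δ ⟩
promote-bangs Γ Δ = ↭⇒≅ unr-↭ (↭-reflexive lin-≡)
  where
  open PermutationReasoning
  unr-↭ : unbang (bangs Γ ++ Δ) ++ [] ↭ unbang Δ ++ Γ
  unr-↭ = begin
    unbang (bangs Γ ++ Δ) ++ []   ≡⟨ List.++-identityʳ _ ⟩
    unbang (bangs Γ ++ Δ)         ≡⟨ concatMap-++ unbang₁ (bangs Γ) Δ ⟩
    unbang (bangs Γ) ++ unbang Δ  ≡⟨ ≡.cong (_++ unbang Δ) (unbang-bangs Γ) ⟩
    Γ ++ unbang Δ                 ↭⟨ ++-comm Γ (unbang Δ) ⟩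
    unbang Δ ++ Γ                 ∎
  lin-≡ : nonbang (bangs Γ ++ Δ) ≡ nonbang Δ
  lin-≡ = ≡.trans (concatMap-++ nonbang₁ (bangs Γ) Δ) (≡.cong (_++ nonbang Δ) (nonbang-bangs Γ))

fire₁ : ∀ A → ⟨ Γ ∣ A ∷ Δ ⟩ ⇒≅ ⟨ unbang₁ A ++ Γ ∣ nonbang₁ A ++ Δ ⟩
fire₁ (atom _) = ⇒≅-refl
fire₁ 𝟏 = ⇒≅-refl
fire₁ (_ ⊗ _) = ⇒≅-refl
fire₁ ⊤ = ⇒≅-refl
fire₁ (_ & _) = ⇒≅-refl
fire₁ (_ ⊸ _) = ⇒≅-refl
fire₁ (! _) = τ⇒⇒≅ bang

fire : ∀ Θ → ⟨ Γ ∣ Θ ++ Δ ⟩ ⇒≅ ⟨ unbang Θ ++ Γ ∣ nonbang Θ ++ Δ ⟩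
fire [] = ⇒≅-refl
fire {Γ} {Δ} (A ∷ Θ) = begin
  ⟨ Γ ∣ A ∷ Θ ++ Δ ⟩
    ∼⟨ ⇒≅-∥ (⇒≅-refl {⟨ [] ∣ [ A ] ⟩}) (fire Θ) ⟩
  ⟨ unbang Θ ++ Γ ∣ A ∷ nonbang Θ ++ Δ ⟩
    ∼⟨ fire₁ A ⟩
  ⟨ unbang₁ A ++ unbang Θ ++ Γ ∣ nonbang₁ A ++ nonbang Θ ++ Δ ⟩
    ≡⟨ ≡.cong₂ ⟨_∣_⟩ (≡.sym (List.++-assoc (unbang₁ A) _ Γ)) (≡.sym (List.++-assoc (nonbang₁ A) _ Δ)) ⟩
  ⟨ unbang (A ∷ Θ) ++ Γ ∣ nonbang (A ∷ Θ) ++ Δ ⟩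
    ∎
  where open ⇒≅-Reasoning

fire-over-promote : ∀ Γ Δ Θ → ⟨ unbang Δ ++ Γ ∣ Θ ++ nonbang Δ ⟩ ⇒≅ promote ⟨ Γ ∣ Θ ++ Δ ⟩
fire-over-promote Γ Δ Θ = begin
  ⟨ unbang Δ ++ Γ ∣ Θ ++ nonbang Δ ⟩                      ∼⟨ fire Θ ⟩
  ⟨ unbang Θ ++ unbang Δ ++ Γ ∣ nonbang Θ ++ nonbang Δ ⟩  ≡⟨ promote-++ Θ ⟨
  promote ⟨ Γ ∣ Θ ++ Δ ⟩                                  ∎
  where open ⇒≅-Reasoning

promote-reachable : ∀ S → S ⇒≅ promote S
promote-reachable ⟨ Γ ∣ Δ ⟩ = begin
  ⟨ Γ ∣ Δ ⟩                           ≡⟨ ≡.cong ⟨ Γ ∣_⟩ (≡.sym (List.++-identityʳ Δ)) ⟩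
  ⟨ Γ ∣ Δ ++ [] ⟩                     ∼⟨ fire Δ ⟩
  ⟨ unbang Δ ++ Γ ∣ nonbang Δ ++ [] ⟩  ≡⟨ ≡.cong ⟨ unbang Δ ++ Γ ∣_⟩ (List.++-identityʳ (nonbang Δ)) ⟩
  promote ⟨ Γ ∣ Δ ⟩                   ∎
  where open ⇒≅-Reasoning

_—[_]→⇒≅_ : State → Label → State → Set
X —[ l ]→⇒≅ Y = Σ State λ Z → (X —[ l ]→ Z) × (Z ⇒≅ Y)

—→⇒≅-resp : X ≅ X' → X' —[ l ]→⇒≅ Y' → Y' ≅ Y → X —[ l ]→⇒≅ Y
—→⇒≅-resp X≅X' (Z , d , Z⇒Y') Y'≅Y = Z , cong X≅X' d ≅-refl , ⇒≅-trans Z⇒Y' (≅⇒⇒≅ Y'≅Y)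

promote-! : X —[ !ₗ a ]→ Y → promote X —[ !ₗ a ]→⇒≅ promote Y
promote-! out = _ , out , ⇒≅-refl
promote-! (cong X≅ d Y≅) = —→⇒≅-resp (promote-resp X≅) (promote-! d) (promote-resp Y≅)

promote-? : X —[ ?ₗ a ]→ Y → promote X —[ ?ₗ a ]→⇒≅ promote Y
promote-? (inp {Γ} {Δ} {B = B}) = _ , inp , fire-over-promote Γ Δ [ B ]
promote-? (cong X≅ d Y≅) = —→⇒≅-resp (promote-resp X≅) (promote-? d) (promote-resp Y≅)

promote-τ : X —[ τ ]→ Y → promote X ⇒≅ promote Y
promote-τ (sync {S₁} {S₁'} {S₂} {S₂'} d₁ d₂) with promote-! d₁ | promote-? d₂
... | Z₁ , e₁ , Z₁⇒ | Z₂ , e₂ , Z₂⇒ = begin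
  promote (S₁ ∥ S₂)          ≈⟨ promote-∥ S₁ S₂ ⟩
  promote S₁ ∥ promote S₂    ∼⟨ τ⇒⇒≅ (sync e₁ e₂) ⟩
  Z₁ ∥ Z₂                    ∼⟨ ⇒≅-∥ Z₁⇒ Z₂⇒ ⟩
  promote S₁' ∥ promote S₂'  ≈⟨ promote-∥ S₁' S₂' ⟨
  promote (S₁' ∥ S₂')        ∎
  where open ⇒≅-Reasoning
promote-τ (tens {Γ} {Δ} {A} {B}) = ⇒≅-trans (τ⇒⇒≅ tens) (fire-over-promote Γ Δ (A ∷ B ∷ []))
promote-τ one = τ⇒⇒≅ one
promote-τ (with₁ {Γ} {Δ} {A}) = ⇒≅-trans (τ⇒⇒≅ with₁) (fire-over-promote Γ Δ [ A ])
promote-τ (with₂ {Γ} {Δ} {B = B}) = ⇒≅-trans (τ⇒⇒≅ with₂) (fire-over-promote Γ Δ [ B ])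
promote-τ (bang {Γ} {Δ} {A}) = ≅⇒⇒≅ (↭⇒≅ (↭-sym (shift A (unbang Δ) Γ)) ↭-refl)
promote-τ (copy {Γ} {Δ} {A} A∈Γ) =
  ⇒≅-trans (τ⇒⇒≅ (copy (∈-++⁺ʳ (unbang Δ) A∈Γ))) (fire-over-promote Γ Δ [ A ])
promote-τ (cong X≅ d Y≅) =
  ⇒≅-trans (≅⇒⇒≅ (promote-resp X≅)) (⇒≅-trans (promote-τ d) (≅⇒⇒≅ (promote-resp Y≅)))

ReachesPromoted : Rel
ReachesPromoted S T = T ⇒≅ promote S

isSimulation-ReachesPromoted : IsSimulation ReachesPromoted
isSimulation-ReachesPromoted = record
  { resp = λ S≅ T≅ T⇒ → ⇒≅-trans (≅⇒⇒≅ (≅-sym T≅)) (⇒≅-trans T⇒ (≅⇒⇒≅ (promote-resp S≅)))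
  ; empty = λ { {Γ₁' = Γ} (Z , T⇒Z , Z≅) S≅ → Γ , Z , T⇒Z , ≅-trans Z≅ (promote-resp S≅) , ⇒≅-refl }
  ; split = λ { {S₁' = S} {S'} (Z , T⇒Z , Z≅) S≅ →
      promote S , promote S' , Z , T⇒Z , ≅-trans Z≅ (≅-trans (promote-resp S≅) (promote-∥ S S')) ,
      ⇒≅-refl , ⇒≅-refl }
  ; stepτ = λ T⇒ d → ⇒≅-unfold (⇒≅-trans T⇒ (promote-τ d))
  ; step! = step!
  ; step? = step?
  }
  where
  step! : ReachesPromoted S T → S —[ !ₗ a ]→ S' →
          Σ State λ T' → (T ⇒[ !ₗ a ] T') × ReachesPromoted S' T'
  step! (Z , T⇒Z , Z≅) d with promote-! d
  ... | W , e , W⇒ = W , (Z , W , T⇒Z , cong Z≅ e ≅-refl , ε) , W⇒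

  -- The extra atom a is placed in parallel and consumed by a synchronisation.
  step? : ReachesPromoted S ⟨ Γ ∣ Δ ⟩ → S —[ ?ₗ a ]→ S' →
          Σ State λ T' → (⟨ Γ ∣ atom a ∷ Δ ⟩ ⇒τ T') × ReachesPromoted S' T'
  step? {a = a} T⇒ d with promote-? d
  ... | W , e , W⇒ = ⇒≅-unfold (⇒≅-trans (⇒≅-∥ (⇒≅-refl {⟨ [] ∣ [ atom a ] ⟩}) T⇒)
                                         (⇒≅-trans (τ⇒⇒≅ (sync out e)) W⇒))

promote-≅⇒≼ₛ : promote S ≅ promote T → S ≼ₛ T
promote-≅⇒≼ₛ {T = T} S≅T =
  ReachesPromoted , isSimulation-ReachesPromoted , ⇒≅-trans (promote-reachable T) (≅⇒⇒≅ (≅-sym S≅T))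

lemma4 : (Γ Δ : List Formula) → Unique Γ →
    (⟨ Γ ∣ Δ ⟩ ≼ₛ ⟨ [] ∣ bangs Γ ++ Δ ⟩) × (⟨ [] ∣ bangs Γ ++ Δ ⟩ ≼ₛ ⟨ Γ ∣ Δ ⟩)
lemma4 Γ Δ _ = promote-≅⇒≼ₛ (≅-sym (promote-bangs Γ Δ)) , promote-≅⇒≼ₛ (promote-bangs Γ Δ)
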